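{- Let $P=(a_{r,j})$ be a strict Sundaram Gelfand–Tsetlin-type pattern (as in the context) with $a_{1,n}>0$, and suppose $O$ is an orientation of the edges of the Sundaram lattice for $P$ satisfying the conditions in the context. Then the right boundary edge of row $0$ points right (away from the lattice). Moreover, for each $k=1,\dots,n$: if $a_{2k+1,n-k+1}=0$, then the right boundary edge of row $n-k+1$ points right and that of row $\overline{n-k+1}$ points left (the loop joining these rows is counterclockwise); if $a_{2k+1,n-k+1}\ne0$, then the right boundary edge of row $\overline{n-k+1}$ points right and that of row $n-k+1$ points left (the loop is clockwise).
   Context: Strict Sundaram Gelfand–Tsetlin-type pattern: an array of nonnegative integers with rows $r=1,\dots,2n+1$, where row $1$ is $(a_{1,1},\dots,a_{1,n},0)$, and for $k=1,\dots,n$ rows $2k$ and $2k+1$ each have $n-k+1$ entries $a_{r,1},\dots,a_{r,n-k+1}$, such that: $a_{r-1,j}\ge a_{r,j}\ge a_{r-1,j+1}$ for $r\ge2$ (with $a_{r-1,j+1}:=0$ if row $r-1$ has only $j$ entries); each row is strictly decreasing; $a_{2k,n-k+1}\ne0$ for all $k$; and $a_{1,k}-a_{2,k}\le1$ for all $k$. Sundaram lattice for $P$: columns labeled $a_{1,1},a_{1,1}-1,\dots,1$ from left to right; $2n+1$ rows labeled from top to bottom $0,\bar n,n,\overline{n-1},n-1,\dots,\bar1,1$, so that the row in position $2k$ from the top is $\overline{n-k+1}$ and the row in position $2k+1$ is $n-k+1$ (position $1$ is row $0$). Each vertex (row–column intersection) has four incident edges; the right boundary edges of rows $i$ and $\bar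 i$ are regarded as joined by a loop. The orientation $O$ satisfies: the vertical edge directly above the vertex in the row at position $r$ and column $c$ points up if $c$ is an entry of row $r$ of $P$ and down otherwise; the vertical edges below the bottom row all point down; all left boundary edges point right (into the lattice); every vertex has exactly two incident edges pointing toward it and two pointing away from it. -}

module Defs where

open import Data.Nat using (ℕ; zero; suc; _+_; _*_; _∸_; _≤_; _<_; _<ᵇ_; ⌊_/2⌋)
open import Data.Bool using (Bool; true; false; not; if_then_else_)
open import Data.Product using (Σ; _×_; ∃-syntax)
open import Relation.Binary.PropositionalEquality using (_≡_; _≢_)
open import Function.Bundles using (_⇔_)

-- A pattern P = (a_{r,j}) is encoded as a function a : ℕ → ℕ → ℕ, a r j = a_{r,j}
-- (1-indexed rows r = 1..2n+1 and entries j = 1..rowLen n r; values outside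
-- this range are irrelevant and never constrained).

-- Number of entries of row r: row 1 has n+1 entries (a_{1,1},…,a_{1,n},0);
-- rows 2k and 2k+1 have n-k+1 entries.  Uniformly: suc (n ∸ ⌊ r /2⌋).
rowLen : ℕ → ℕ → ℕ
rowLen n r = suc (n ∸ ⌊ r /2⌋)

InRow : ℕ → (ℕ → ℕ → ℕ) → ℕ → ℕ → Set
InRow n a r c = ∃[ j ] (1 ≤ j × j ≤ rowLen n r × a r j ≡ c)

record StrictSundaramGT (n : ℕ) (a : ℕ → ℕ → ℕ) : Set where
  field
    row1-last : a 1 (suc n) ≡ 0
    interlace-upper : ∀ r j → 2 ≤ r → r ≤ 2 * n + 1 → 1 ≤ j → j ≤ rowLen n r →
                      a r j ≤ a (r ∸ 1) j
    -- (when row r-1 has only j entries, a_{r-1,j+1} := 0 and the bound is trivial)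
    interlace-lower : ∀ r j → 2 ≤ r → r ≤ 2 * n + 1 → 1 ≤ j → j ≤ rowLen n r →
                      suc j ≤ rowLen n (r ∸ 1) → a (r ∸ 1) (suc j) ≤ a r j
    strict : ∀ r j → 1 ≤ r → r ≤ 2 * n + 1 → 1 ≤ j → suc j ≤ rowLen n r →
             a r (suc j) < a r j
    even-last-nonzero : ∀ k → 1 ≤ k → k ≤ n → a (2 * k) (suc (n ∸ k)) ≢ 0
    top-diff : ∀ k → 1 ≤ k → k ≤ n → a 1 k ≤ a 2 k + 1

-- Sundaram lattice: row positions r = 1..2n+1 (position 1 = row 0, position 2k =
-- row \overline{n-k+1}, position 2k+1 = row n-k+1), columns labelled c = m, m-1, …, 1
-- from left to right where m = a_{1,1}.  Vertex (r,c) for 1 ≤ r ≤ 2n+1, 1 ≤ c ≤ m.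
--
-- An orientation consists of
--   up r c  : the vertical edge directly above vertex (r,c) points up
--   hor r c : (0 ≤ c ≤ m) the horizontal edge in row r lying between column c+1
--             (on the left) and column c (on the right) points right.
--             hor r m is the left boundary edge, hor r 0 the right boundary edge.
-- The vertical edge below vertex (r,c), for r < 2n+1, is the edge above (r+1,c);
-- the edges below the bottom row are fixed to point down.
record Orientation : Set where
  field
    up  : ℕ → ℕ → Bool
    hor : ℕ → ℕ → Bool

χ : Bool → ℕ
χ b = if b then 1 else 0

belowUp : ℕ → Orientation → ℕ → ℕ → Bool
belowUp n O r c with r <ᵇ 2 * n + 1
... | true  = Orientation.up O (suc r) c
... | false = false

inDeg : ℕ → Orientation → ℕ → ℕ → ℕ
inDeg n O r c =
  χ (hor r c) + χ (not (hor r (c ∸ 1))) + χ (not (up r c)) + χ (belowUp n O r c)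
  where open Orientation O

record IsSundaramOrientation (n : ℕ) (a : ℕ → ℕ → ℕ) (O : Orientation) : Set where
  open Orientation O
  field
    up-spec : ∀ r c → 1 ≤ r → r ≤ 2 * n + 1 → 1 ≤ c → c ≤ a 1 1 →
              (up r c ≡ true) ⇔ InRow n a r c
    left-boundary : ∀ r → 1 ≤ r → r ≤ 2 * n + 1 → hor r (a 1 1) ≡ true
    ice-rule : ∀ r c → 1 ≤ r → r ≤ 2 * n + 1 → 1 ≤ c → c ≤ a 1 1 →
               inDeg n O r c ≡ 2
    -- the right boundary edges of rows \overline{n-k+1} (position 2k) and n-k+1
    -- (position 2k+1) are joined by a loop, a single edge: one points right
    -- exactly when the other points left
    loop : ∀ k → 1 ≤ k → k ≤ n → hor (2 * k) 0 ≡ not (hor (2 * k + 1) 0)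

-- Each row of the lattice obeys a conservation law: summing the ice rule along
-- row r, the up-pointing vertical edges above the row plus [right boundary edge
-- points right] equal the up-pointing edges below the row plus one (the left
-- boundary edge points in).  The up-pointing edges above row r sit at the
-- columns c ∈ [1, a₁₁] occurring in row r of P; as the row decreases strictly,
-- there are (row length − 1) + [last entry > 0] of them.  So row 2k has
-- n − k + 1 such edges, row 2k+1 has n − k + [a_{2k+1,n−k+1} > 0] (for k = 0
-- this is row 1, whose last entry is 0), and below the bottom row there are
-- none; comparing neighbouring rows pins down every right boundary edge.
module Submission where

open import Defs
open import Data.Bool using (Bool; true; false; not; T)
open import Data.Bool.Properties using (¬-not)
open import Data.Nat using (ℕ; zero; suc; _+_; _*_; _∸_; _≤_; _<_; z≤n; s≤s; ⌊_/2⌋; _<ᵇ_)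
open import Data.Nat.Properties
open import Algebra.Properties.CommutativeSemigroup +-commutativeSemigroup
  using (xy∙z≈xz∙y; x∙yz≈y∙xz)
open import Data.Product using (_×_; _,_; ∃-syntax)
open import Data.Sum using (inj₁; inj₂)
open import Data.Unit using (tt)
open import Function using (_∘_)
open import Function.Bundles using (_⇔_; Equivalence; mk⇔)
open import Relation.Nullary using (¬_; contradiction)
open import Relation.Binary.PropositionalEquality
  using (_≡_; _≢_; refl; sym; trans; cong; cong₂; subst; module ≡-Reasoning)

open ≡-Reasoning

χ-injective : ∀ b b′ → χ b ≡ χ b′ → b ≡ b′
χ-injective false false _ = refl
χ-injective true  true  _ = refl

χ-complement : ∀ b b′ → χ b + χ b′ ≡ 1 → b ≡ not b′
χ-complement false true  _ = refl
χ-complement true  false _ = refl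

≢0⇒0<ᵇ : ∀ {x} → x ≢ 0 → (0 <ᵇ x) ≡ true
≢0⇒0<ᵇ {zero}  x≢0 = contradiction refl x≢0
≢0⇒0<ᵇ {suc x} _   = refl

⌊2*n/2⌋≡n : ∀ n → ⌊ 2 * n /2⌋ ≡ n
⌊2*n/2⌋≡n n = trans (cong (λ m → ⌊ n + m /2⌋) (+-identityʳ n)) (sym (n≡⌊n+n/2⌋ n))

⌊1+2*n/2⌋≡n : ∀ n → ⌊ suc (2 * n) /2⌋ ≡ n
⌊1+2*n/2⌋≡n zero    = refl
⌊1+2*n/2⌋≡n (suc n) = trans (cong (λ m → ⌊ suc m /2⌋) (*-suc 2 n)) (cong suc (⌊1+2*n/2⌋≡n n))

⌊2*n+1/2⌋≡n : ∀ n → ⌊ 2 * n + 1 /2⌋ ≡ n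
⌊2*n+1/2⌋≡n n = trans (cong ⌊_/2⌋ (+-comm (2 * n) 1)) (⌊1+2*n/2⌋≡n n)

countTrue : (ℕ → Bool) → ℕ → ℕ
countTrue g zero    = 0
countTrue g (suc m) = countTrue g m + χ (g (suc m))

countTrue-cong : ∀ {g h} m → (∀ c → 1 ≤ c → c ≤ m → g c ≡ h c) →
                 countTrue g m ≡ countTrue h m
countTrue-cong zero    _   = refl
countTrue-cong (suc m) g≗h =
  cong₂ _+_ (countTrue-cong m (λ c p q → g≗h c p (m≤n⇒m≤1+n q)))
            (cong χ (g≗h (suc m) (s≤s z≤n) ≤-refl))

countTrue-above : ∀ g {v} m → v ≤ m → (∀ c → v < c → c ≤ m → g c ≡ false) →
                  countTrue g m ≡ countTrue g v
countTrue-above g m v≤m g≡false with m≤n⇒m<n∨m≡n v≤m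
... | inj₂ refl = refl
countTrue-above g {v} (suc m) _ g≡false | inj₁ (s≤s v≤m) = begin
  countTrue g m + χ (g (suc m))  ≡⟨ cong (λ b → countTrue g m + χ b) top-false ⟩
  countTrue g m + 0              ≡⟨ +-identityʳ _ ⟩
  countTrue g m                  ≡⟨ countTrue-above g m v≤m (λ c p q → g≡false c p (m≤n⇒m≤1+n q)) ⟩
  countTrue g v                  ∎
  where
  top-false : g (suc m) ≡ false
  top-false = g≡false (suc m) (s≤s v≤m) ≤-refl

-- The ice rule at a vertex whose left, right, upper and lower edges are a, b, u, d,
-- horizontal edges read as "points right" and vertical ones as "points up".
ice-balance : ∀ a b u d → χ a + χ (not b) + χ (not u) + χ d ≡ 2 → χ b + χ u ≡ χ a + χ d
ice-balance true  true  true  true  _ = refl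
ice-balance true  true  false false _ = refl
ice-balance true  false true  false _ = refl
ice-balance false true  false true  _ = refl
ice-balance false false true  true  _ = refl
ice-balance false false false false _ = refl
ice-balance true  true  true  false ()
ice-balance true  true  false true  ()
ice-balance true  false true  true  ()
ice-balance true  false false true  ()
ice-balance true  false false false ()
ice-balance false true  true  true  ()
ice-balance false true  true  false ()
ice-balance false true  false false ()
ice-balance false false true  false ()
ice-balance false false false true  ()

row-flux : ∀ (h u d : ℕ → Bool) t →
           (∀ c → 1 ≤ c → c ≤ t → χ (h c) + χ (not (h (c ∸ 1))) + χ (not (u c)) + χ (d c) ≡ 2) →
           χ (h 0) + countTrue u t ≡ χ (h t) + countTrue d t
row-flux h u d zero    _   = refl
row-flux h u d (suc t) ice = begin
  χ (h 0) + (U + χ (u (suc t)))                 ≡⟨ sym (+-assoc (χ (h 0)) U _) ⟩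
  χ (h 0) + U + χ (u (suc t))                   ≡⟨ cong (_+ χ (u (suc t))) flux-t ⟩
  χ (h t) + D + χ (u (suc t))                   ≡⟨ xy∙z≈xz∙y (χ (h t)) D _ ⟩
  χ (h t) + χ (u (suc t)) + D                   ≡⟨ cong (_+ D) balance ⟩
  χ (h (suc t)) + χ (d (suc t)) + D             ≡⟨ xy∙z≈xz∙y (χ (h (suc t))) _ D ⟩
  χ (h (suc t)) + D + χ (d (suc t))             ≡⟨ +-assoc (χ (h (suc t))) D _ ⟩
  χ (h (suc t)) + (D + χ (d (suc t)))           ∎
  where
  U = countTrue u t
  D = countTrue d t
  flux-t : χ (h 0) + U ≡ χ (h t) + D
  flux-t = row-flux h u d t (λ c p q → ice c p (m≤n⇒m≤1+n q))
  balance : χ (h t) + χ (u (suc t)) ≡ χ (h (suc t)) + χ (d (suc t))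
  balance =
    ice-balance (h (suc t)) (h t) (u (suc t)) (d (suc t)) (ice (suc t) (s≤s z≤n) ≤-refl)

IsValueOf : ℕ → (ℕ → ℕ) → ℕ → Set
IsValueOf L x c = ∃[ j ] (1 ≤ j × j ≤ L × x j ≡ c)

IndicatorOn : ℕ → (ℕ → Bool) → (ℕ → Set) → Set
IndicatorOn m g P = ∀ c → 1 ≤ c → c ≤ m → (g c ≡ true) ⇔ P c

indicator-false : ∀ {m g P c} → IndicatorOn m g P → 1 ≤ c → c ≤ m → ¬ P c → g c ≡ false
indicator-false g⇔P p q ¬Pc = ¬-not (¬Pc ∘ Equivalence.to (g⇔P _ p q))

StrictlyDecreasing : ℕ → (ℕ → ℕ) → Set
StrictlyDecreasing L x = ∀ j → 1 ≤ j → suc j ≤ L → x (suc j) < x j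

tail-decreasing : ∀ {L x} → StrictlyDecreasing (suc L) x → StrictlyDecreasing L (x ∘ suc)
tail-decreasing dec j _ q = dec (suc j) (s≤s z≤n) (s≤s q)

head-max : ∀ {L x} → StrictlyDecreasing L x → ∀ j → 1 ≤ j → j ≤ L → x j ≤ x 1
head-max dec (suc zero)    _ _ = ≤-refl
head-max dec (suc (suc j)) _ q =
  ≤-trans (<⇒≤ (dec (suc j) (s≤s z≤n) q)) (head-max dec (suc j) (s≤s z≤n) (<⇒≤ q))

value-≤-head : ∀ {L x c} → StrictlyDecreasing L x → IsValueOf L x c → c ≤ x 1
value-≤-head dec (j , p , q , refl) = head-max dec j p q

indicator-tail : ∀ {L x m g v} → v < x 1 → v ≤ m →
                 IndicatorOn m g (IsValueOf (suc L) x) → IndicatorOn v g (IsValueOf L (x ∘ suc))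
indicator-tail {L} {x} {g = g} v<x₁ v≤m g⇔val c p c≤v = mk⇔
  (tail ∘ Equivalence.to g⇔valᶜ)
  (λ (j , _ , j≤L , e) → Equivalence.from g⇔valᶜ (suc j , s≤s z≤n , s≤s j≤L , e))
  where
  g⇔valᶜ : (g c ≡ true) ⇔ IsValueOf (suc L) x c
  g⇔valᶜ = g⇔val c p (≤-trans c≤v v≤m)
  tail : IsValueOf (suc L) x c → IsValueOf L (x ∘ suc) c
  tail (suc zero    , _ , _       , refl) = contradiction v<x₁ (≤⇒≯ c≤v)
  tail (suc (suc j) , _ , s≤s j≤L , e)    = suc j , s≤s z≤n , j≤L , e

positives : ℕ → (ℕ → ℕ) → ℕ
positives zero    x = 0
positives (suc L) x = χ (0 <ᵇ x 1) + positives L (x ∘ suc)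

positives-zero : ∀ L {x} → (∀ j → 1 ≤ j → j ≤ L → x j ≤ 0) → positives L x ≡ 0
positives-zero zero    _   = refl
positives-zero (suc L) x≤0 rewrite n≤0⇒n≡0 (x≤0 1 ≤-refl (s≤s z≤n)) =
  positives-zero L (λ j _ q → x≤0 (suc j) (s≤s z≤n) (s≤s q))

positives-decreasing : ∀ L {x} → StrictlyDecreasing (suc L) x →
                       positives (suc L) x ≡ L + χ (0 <ᵇ x (suc L))
positives-decreasing zero    _ = +-identityʳ _
positives-decreasing (suc L) {x} dec with x 1 | dec 1 ≤-refl (s≤s (s≤s z≤n))
... | suc _ | _ = cong suc (positives-decreasing L (tail-decreasing dec))

-- Peel off the largest value x₁: the columns above it contribute nothing, column
-- x₁ contributes one, and the remaining values indicate the columns below x₁.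
countTrue-values : ∀ L {x m g} → StrictlyDecreasing L x → (1 ≤ L → x 1 ≤ m) →
                   IndicatorOn m g (IsValueOf L x) → countTrue g m ≡ positives L x
countTrue-values zero {m = m} {g} _ _ g⇔val =
  countTrue-above g m z≤n λ c p q →
    indicator-false g⇔val p q λ (_ , 1≤j , j≤0 , _) → n≮0 (≤-trans 1≤j j≤0)
countTrue-values (suc L) {x} {m} {g} dec x₁≤m g⇔val with x 1 in x₁≡
... | zero = trans (countTrue-above g m z≤n noValue) (sym (positives-zero L tail≤0))
  where
  noValue : ∀ c → 0 < c → c ≤ m → g c ≡ false
  noValue c p q = indicator-false g⇔val p q λ val →
    n≮0 (≤-trans p (subst (c ≤_) x₁≡ (value-≤-head dec val)))
  tail≤0 : ∀ j → 1 ≤ j → j ≤ L → x (suc j) ≤ 0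
  tail≤0 j _ q = subst (x (suc j) ≤_) x₁≡ (head-max dec (suc j) (s≤s z≤n) (s≤s q))
... | suc v = begin
  countTrue g m                      ≡⟨ countTrue-above g m v<m noValueAbove ⟩
  countTrue g v + χ (g (suc v))      ≡⟨ cong₂ _+_ below (cong χ top) ⟩
  positives L (x ∘ suc) + 1          ≡⟨ +-comm _ 1 ⟩
  1 + positives L (x ∘ suc)          ∎
  where
  v<m : suc v ≤ m
  v<m = x₁≤m (s≤s z≤n)
  noValueAbove : ∀ c → suc v < c → c ≤ m → g c ≡ false
  noValueAbove c p q = indicator-false g⇔val (≤-trans (s≤s z≤n) p) q λ val →
    <⇒≱ p (subst (c ≤_) x₁≡ (value-≤-head dec val))
  top : g (suc v) ≡ true
  top = Equivalence.from (g⇔val (suc v) (s≤s z≤n) v<m) (1 , ≤-refl , s≤s z≤n , x₁≡)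
  below : countTrue g v ≡ positives L (x ∘ suc)
  below = countTrue-values L (tail-decreasing dec)
            (λ p → ≤-pred (subst (x 2 <_) x₁≡ (dec 1 ≤-refl (s≤s p))))
            (indicator-tail (subst (v <_) (sym x₁≡) ≤-refl) (<⇒≤ v<m) g⇔val)

module RowCounts {n a O} (P : StrictSundaramGT n a) (S : IsSundaramOrientation n a O) where
  open StrictSundaramGT P
  open IsSundaramOrientation S
  open Orientation O

  upCount : ℕ → ℕ
  upCount r = countTrue (up r) (a 1 1)

  downCount : ℕ → ℕ
  downCount r = countTrue (belowUp n O r) (a 1 1)

  lastOdd : ℕ → ℕ
  lastOdd k = a (2 * k + 1) (suc (n ∸ k))

  1≤2k : ∀ {k} → 1 ≤ k → 1 ≤ 2 * k
  1≤2k {k} p = ≤-trans p (m≤m+n k _)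

  2k≤2n+1 : ∀ {k} → k ≤ n → 2 * k ≤ 2 * n + 1
  2k≤2n+1 q = ≤-trans (*-monoʳ-≤ 2 q) (m≤m+n _ 1)

  1≤2k+1 : ∀ k → 1 ≤ 2 * k + 1
  1≤2k+1 k = m≤n+m 1 (2 * k)

  2k+1≤2n+1 : ∀ {k} → k ≤ n → 2 * k + 1 ≤ 2 * n + 1
  2k+1≤2n+1 q = +-monoˡ-≤ 1 (*-monoʳ-≤ 2 q)

  row-balance : ∀ r → 1 ≤ r → r ≤ 2 * n + 1 → χ (hor r 0) + upCount r ≡ 1 + downCount r
  row-balance r p q =
    trans (row-flux (hor r) (up r) (belowUp n O r) (a 1 1) (λ c → ice-rule r c p q))
          (cong (λ b → χ b + downCount r) (left-boundary r p q))

  entry-≤-corner : ∀ r → 1 ≤ r → r ≤ 2 * n + 1 → a r 1 ≤ a 1 1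
  entry-≤-corner (suc zero)    _ _ = ≤-refl
  entry-≤-corner (suc (suc r)) _ q =
    ≤-trans (interlace-upper (suc (suc r)) 1 (s≤s (s≤s z≤n)) q ≤-refl (s≤s z≤n))
            (entry-≤-corner (suc r) (s≤s z≤n) (<⇒≤ q))

  upCount-row : ∀ r → 1 ≤ r → r ≤ 2 * n + 1 →
                upCount r ≡ n ∸ ⌊ r /2⌋ + χ (0 <ᵇ a r (rowLen n r))
  upCount-row r p q =
    trans (countTrue-values (rowLen n r) (λ j → strict r j p q) (λ _ → entry-≤-corner r p q)
                            (λ c → up-spec r c p q))
          (positives-decreasing (n ∸ ⌊ r /2⌋) (λ j → strict r j p q))

  upCount-half : ∀ r {k} → ⌊ r /2⌋ ≡ k → 1 ≤ r → r ≤ 2 * n + 1 →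
                 upCount r ≡ n ∸ k + χ (0 <ᵇ a r (suc (n ∸ k)))
  upCount-half r refl = upCount-row r

  upCount-even : ∀ k → 1 ≤ k → k ≤ n → upCount (2 * k) ≡ suc (n ∸ k)
  upCount-even k p q = begin
    upCount (2 * k)                           ≡⟨ upCount-half (2 * k) (⌊2*n/2⌋≡n k) (1≤2k p) (2k≤2n+1 q) ⟩
    n ∸ k + χ (0 <ᵇ a (2 * k) (suc (n ∸ k)))  ≡⟨ cong (λ b → n ∸ k + χ b) (≢0⇒0<ᵇ (even-last-nonzero k p q)) ⟩
    n ∸ k + 1                                 ≡⟨ +-comm (n ∸ k) 1 ⟩
    suc (n ∸ k)                               ∎

  upCount-odd : ∀ k → k ≤ n → upCount (2 * k + 1) ≡ n ∸ k + χ (0 <ᵇ lastOdd k)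
  upCount-odd k q = upCount-half (2 * k + 1) (⌊2*n+1/2⌋≡n k) (1≤2k+1 k) (2k+1≤2n+1 q)

  belowUp-inner : ∀ r c → r < 2 * n + 1 → belowUp n O r c ≡ up (suc r) c
  belowUp-inner r c r<bottom with r <ᵇ 2 * n + 1 | <⇒<ᵇ r<bottom
  ... | true | _ = refl

  belowUp-bottom : ∀ c → belowUp n O (2 * n + 1) c ≡ false
  belowUp-bottom c with (2 * n + 1) <ᵇ (2 * n + 1) in eq
  ... | false = refl
  ... | true  = contradiction (<ᵇ⇒< (2 * n + 1) _ (subst T (sym eq) tt)) (n≮n _)

  downCount-inner : ∀ r → r < 2 * n + 1 → downCount r ≡ upCount (suc r)
  downCount-inner r r<bottom = countTrue-cong (a 1 1) (λ c _ _ → belowUp-inner r c r<bottom)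

  downCount-even : ∀ k → k ≤ n → downCount (2 * k) ≡ upCount (2 * k + 1)
  downCount-even k q =
    trans (downCount-inner (2 * k) (subst (_≤ 2 * n + 1) (+-comm (2 * k) 1) (2k+1≤2n+1 q)))
          (cong upCount (+-comm 1 (2 * k)))

  downCount-odd : ∀ k → k ≤ n → downCount (2 * k + 1) ≡ n ∸ k
  downCount-odd k k≤n with m≤n⇒m<n∨m≡n k≤n
  ... | inj₂ refl =
    trans (countTrue-above (belowUp n O (2 * n + 1)) (a 1 1) z≤n (λ c _ _ → belowUp-bottom c))
          (sym (n∸n≡0 n))
  ... | inj₁ k<n = begin
    downCount (2 * k + 1)      ≡⟨ downCount-inner (2 * k + 1) (subst (_≤ 2 * n + 1) (sym next) (2k≤2n+1 k<n)) ⟩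
    upCount (suc (2 * k + 1))  ≡⟨ cong upCount next ⟩
    upCount (2 * suc k)        ≡⟨ upCount-even (suc k) (s≤s z≤n) k<n ⟩
    suc (n ∸ suc k)            ≡⟨ sym (+-∸-assoc 1 k<n) ⟩
    n ∸ k                      ∎
    where
    next : suc (2 * k + 1) ≡ 2 * suc k
    next = trans (cong suc (+-comm (2 * k) 1)) (sym (*-suc 2 k))

  hor-odd : ∀ k → k ≤ n → hor (2 * k + 1) 0 ≡ not (0 <ᵇ lastOdd k)
  hor-odd k q = χ-complement _ _ (+-cancelˡ-≡ (n ∸ k) _ _ (begin
    n ∸ k + (H + Z)            ≡⟨ x∙yz≈y∙xz (n ∸ k) H Z ⟩
    H + (n ∸ k + Z)            ≡⟨ cong (H +_) (sym (upCount-odd k q)) ⟩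
    H + upCount (2 * k + 1)    ≡⟨ row-balance (2 * k + 1) (1≤2k+1 k) (2k+1≤2n+1 q) ⟩
    1 + downCount (2 * k + 1)  ≡⟨ cong (1 +_) (downCount-odd k q) ⟩
    1 + (n ∸ k)                ≡⟨ +-comm 1 (n ∸ k) ⟩
    n ∸ k + 1                  ∎))
    where
    H = χ (hor (2 * k + 1) 0)
    Z = χ (0 <ᵇ lastOdd k)

  hor-even : ∀ k → 1 ≤ k → k ≤ n → hor (2 * k) 0 ≡ (0 <ᵇ lastOdd k)
  hor-even k p q = χ-injective _ _ (+-cancelʳ-≡ (n ∸ k) H Z (trans H+s≡s+Z (+-comm (n ∸ k) Z)))
    where
    H = χ (hor (2 * k) 0)
    Z = χ (0 <ᵇ lastOdd k)
    H+s≡s+Z : H + (n ∸ k) ≡ n ∸ k + Z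
    H+s≡s+Z = suc-injective (begin
      suc (H + (n ∸ k))      ≡⟨ sym (+-suc H (n ∸ k)) ⟩
      H + suc (n ∸ k)        ≡⟨ cong (H +_) (sym (upCount-even k p q)) ⟩
      H + upCount (2 * k)    ≡⟨ row-balance (2 * k) (1≤2k p) (2k≤2n+1 q) ⟩
      1 + downCount (2 * k)  ≡⟨ cong (1 +_) (trans (downCount-even k q) (upCount-odd k q)) ⟩
      suc (n ∸ k + Z)        ∎)

mainTheorem3 : (n : ℕ) (a : ℕ → ℕ → ℕ) → 1 ≤ n → StrictSundaramGT n a → 0 < a 1 n →
               (O : Orientation) → IsSundaramOrientation n a O →
               Orientation.hor O 1 0 ≡ true
               × (∀ k → 1 ≤ k → k ≤ n →
                    (a (2 * k + 1) (suc (n ∸ k)) ≡ 0 →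
                       Orientation.hor O (2 * k + 1) 0 ≡ true × Orientation.hor O (2 * k) 0 ≡ false)
                  × (a (2 * k + 1) (suc (n ∸ k)) ≢ 0 →
                       Orientation.hor O (2 * k) 0 ≡ true × Orientation.hor O (2 * k + 1) 0 ≡ false))
mainTheorem3 n a _ P _ O S =
    trans (hor-odd 0 z≤n) (cong (not ∘ (0 <ᵇ_)) (StrictSundaramGT.row1-last P))
  , λ k p q →
      (λ z≡0 → trans (hor-odd k q) (cong (not ∘ (0 <ᵇ_)) z≡0)
             , trans (hor-even k p q) (cong (0 <ᵇ_) z≡0))
    , (λ z≢0 → trans (hor-even k p q) (≢0⇒0<ᵇ z≢0)
             , trans (hor-odd k q) (cong not (≢0⇒0<ᵇ z≢0)))
  where
  open RowCounts P S
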